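{- Let $V$ be a truth value set, $\triangleright$ a total order on $V$, and $\widehat{R}:V\to V$ a modification operator corresponding to a choice operator $\breve{R}$ with respect to $\triangleright$. Then $\widehat{R}$ is a bijection from $V$ to $V$.
   Context: A truth value set is a set $V\subseteq[0,1]$ with $\{0,1\}\subseteq V$ and $1-v\in V$ for every $v\in V$. An $n$-adic truth function operator is a map $V^n\to V$. Formulas are built from propositional variables using truth function operators; a valuation $v$ assigns to each formula a value in $V$ homomorphically: $v(R(\phi_1,\dots,\phi_n))=R(v(\phi_1),\dots,v(\phi_n))$. For a total order $\triangleright$ on $V$, an element $x$ and a nonempty $Y\subseteq V$, write $x\triangleright Y$ if $x\triangleright y$ for all $y\in Y$, and $Y\triangleright x$ if $y\triangleright x$ for all $y\in Y$. A choice operator with respect to $\triangleright$ is an operator $\breve{R}:V^n\to V$ with $n\ge 2$ such that $v(\breve{R}(\phi_1,\dots,\phi_n))=v(\phi_i)$ where $v(\phi_i)\triangleright\{v(\phi_j)\mid j\ne i\}$ (it returns the $\triangleright$-greatest argument). A modification operator corresponding to $\breve{R}$ is an operator $\widehat{R}:V\to V$ such that whenever $v(\breve{R}(\phi_1,\dots,\phi_n))=v(\phi_i)$ and $v(\phi_i)\triangleright\{v(\phi_j)\mid j\neq i\}$, one has $\{v(\widehat{R}(\phi_j))\mid j\ne i\}\triangleright v(\widehat{R}(\phi_i))$ and $v(\widehat{R}(\widehat{R}(\phi_i)))=v(\phi_i)$. -}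

module Defs where

open import Level using (0ℓ)
open import Data.Nat using (ℕ; _≤_)
open import Data.Fin using (Fin)
open import Data.Product using (Σ; _×_)
open import Relation.Binary.Core using (Rel)
open import Relation.Binary.PropositionalEquality using (_≡_; _≢_)
open import Function.Definitions using (Injective)

-- A truth value set: a subset V of an ambient "unit interval" containing
-- 0 and 1 and closed under v ↦ 1 - v.
record TruthValueSet : Set₁ where
  field
    Ambient    : Set
    zeroA oneA : Ambient
    oneMinus   : Ambient → Ambient
    V          : Set
    ι          : V → Ambient
    ι-injective : Injective _≡_ _≡_ ι
    has-0      : Σ V (λ v → ι v ≡ zeroA)
    has-1      : Σ V (λ v → ι v ≡ oneA)
    closed-neg : (v : V) → Σ V (λ w → ι w ≡ oneMinus (ι v))

module _ {V : Set} (_⊵_ : Rel V 0ℓ) where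

  Dominates : {n : ℕ} → (Fin n → V) → Fin n → Set
  Dominates xs i = ∀ j → j ≢ i → xs i ⊵ xs j

  DominatedBy : {n : ℕ} → (V → V) → (Fin n → V) → Fin n → Set
  DominatedBy f xs i = ∀ j → j ≢ i → f (xs j) ⊵ f (xs i)

  IsChoiceOperator : (n : ℕ) → ((Fin n → V) → V) → Set
  IsChoiceOperator n R˘ =
    (2 ≤ n) × (∀ (xs : Fin n → V) (i : Fin n) → Dominates xs i → R˘ xs ≡ xs i)

  IsModificationOperator : (n : ℕ) → ((Fin n → V) → V) → (V → V) → Set
  IsModificationOperator n R˘ R^ =
    ∀ (xs : Fin n → V) (i : Fin n) → R˘ xs ≡ xs i → Dominates xs i →
      DominatedBy R^ xs i × (R^ (R^ (xs i)) ≡ xs i)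

module Submission where

-- Idea: feed the choice operator a constant family  x, x, …, x.  By
-- reflexivity of the order every position dominates all the others, so
-- the choice operator returns x at a chosen position i, and the defining
-- property of the modification operator R^ at that position yields
-- R^ (R^ x) ≡ x.  Hence R^ is an involution, i.e. its own two-sided
-- inverse, and therefore a bijection.

open import Defs
open import Level using (0ℓ)
open import Data.Nat using (ℕ; suc; s≤s)
open import Data.Product using (_,_; proj₂)
open import Data.Fin using (Fin; zero)
open import Relation.Binary.Core using (Rel)
open import Relation.Binary.Definitions using (Reflexive)
open import Relation.Binary.Structures using (IsTotalOrder)
open import Relation.Binary.PropositionalEquality using (_≡_)
open import Function.Definitions using (Bijective)
open import Function.Consequences.Propositional
  using (inverseᵇ⇒bijective; strictlyInverseˡ⇒inverseˡ; strictlyInverseʳ⇒inverseʳ)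

involution⇒bijective : {A : Set} (f : A → A) → (∀ x → f (f x) ≡ x) →
  Bijective _≡_ _≡_ f
involution⇒bijective f f∘f≡id = inverseᵇ⇒bijective
  (strictlyInverseˡ⇒inverseˡ f f∘f≡id , strictlyInverseʳ⇒inverseʳ f f∘f≡id)

module _ {V : Set} (_⊵_ : Rel V 0ℓ) (⊵-refl : Reflexive _⊵_) where

  constant-dominates : {n : ℕ} (x : V) (i : Fin n) →
    Dominates _⊵_ (λ _ → x) i
  constant-dominates x i _ _ = ⊵-refl

  -- A modification operator of an arity-(suc k) choice operator is an
  -- involution: apply both defining properties to the constant family.
  modification-involutive : {k : ℕ}
    (R˘ : (Fin (suc k) → V) → V) (R^ : V → V) →
    (∀ (xs : Fin (suc k) → V) (i : Fin (suc k)) →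
       Dominates _⊵_ xs i → R˘ xs ≡ xs i) →
    IsModificationOperator _⊵_ (suc k) R˘ R^ →
    ∀ x → R^ (R^ x) ≡ x
  modification-involutive R˘ R^ chooses modifies x =
    proj₂ (modifies xs zero (chooses xs zero dominant) dominant)
    where
    xs : Fin _ → V
    xs _ = x

    dominant : Dominates _⊵_ xs zero
    dominant = constant-dominates x zero

theorem2 : (T : TruthValueSet) → (_⊵_ : Rel (TruthValueSet.V T) 0ℓ) →
    IsTotalOrder _≡_ _⊵_ →
    (n : ℕ) (R˘ : (Fin n → TruthValueSet.V T) → TruthValueSet.V T)
    (R^ : TruthValueSet.V T → TruthValueSet.V T) →
    IsChoiceOperator _⊵_ n R˘ →
    IsModificationOperator _⊵_ n R˘ R^ →
    Bijective _≡_ _≡_ R^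
-- The arity bound 2 ≤ n rules out n = 0, so an argument position exists.
theorem2 T _⊵_ total (suc k) R˘ R^ (s≤s _ , chooses) modifies =
  involution⇒bijective R^
    (modification-involutive _⊵_ (IsTotalOrder.refl total) R˘ R^ chooses modifies)
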